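{- The semiregular planar tiling $(3.p.3.p.3.p)$ has exactly one perfect precise $6$-coloring if and only if $p$ is a multiple of $3$.
   Context: A semiregular tiling $(p_1.p_2.\cdots.p_k)$ of the plane (spherical, Euclidean or hyperbolic) is an edge-to-edge tiling by regular polygons in which around every vertex there occur a $p_1$-gon, ..., a $p_k$-gon in this cyclic order or in reverse; it is $k$-valent. An $n$-coloring is a surjective map from the set of tiles to a set of $n$ colors. For a $k$-valent tiling, a $k$-coloring is precise if all $k$ colors appear at every vertex. A coloring is perfect if every element of the symmetry group $G$ of the uncolored tiling permutes the colors (maps each color class onto a color class). Colorings are counted as partitions of the tiles into color classes, up to the action of the symmetry group of the tiling. -}

module Defs where

open import Data.Nat using (ℕ; zero; suc)
open import Data.Fin using (Fin)
open import Data.List using (List; []; _∷_; _++_)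
open import Data.Product using (Σ; ∃; _×_; _,_)
open import Data.Sum using (_⊎_)
open import Data.Fin.Permutation using (Permutation′; _⟨$⟩ʳ_)
open import Relation.Binary.PropositionalEquality using (_≡_)
open import Relation.Binary.Construct.Closure.ReflexiveTransitive using (Star)

-- Generators of the triangle group Δ(3,3,p): reflections rA, rB, rC in the
-- sides of a triangle ABC with angles π/3 at A, π/3 at B, π/p at C
-- (rA = reflection in side BC, rB in side CA, rC in side AB).
data Gen : Set where
  rA rB rC : Gen

Word : Set
Word = List Gen

alt : ℕ → Gen → Gen → Word
alt zero    x y = []
alt (suc n) x y = x ∷ y ∷ alt n x y

data Relator (p : ℕ) : Word → Set where
  invA : Relator p (rA ∷ rA ∷ [])
  invB : Relator p (rB ∷ rB ∷ [])
  invC : Relator p (rC ∷ rC ∷ [])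
  angA : Relator p (alt 3 rC rB)
  angB : Relator p (alt 3 rC rA)
  angC : Relator p (alt p rA rB)

data _∼⟨_⟩_ : Word → ℕ → Word → Set where
  ∼refl  : ∀ {p u} → u ∼⟨ p ⟩ u
  ∼sym   : ∀ {p u v} → u ∼⟨ p ⟩ v → v ∼⟨ p ⟩ u
  ∼trans : ∀ {p u v w} → u ∼⟨ p ⟩ v → v ∼⟨ p ⟩ w → u ∼⟨ p ⟩ w
  ∼rel   : ∀ {p} u r v → Relator p r → (u ++ (r ++ v)) ∼⟨ p ⟩ (u ++ v)

-- Two flag orbits under Δ(3,3,p): the base flag F_T = (A, e, triangle at B)
-- and F_P = (A, e, p-gon at C), where e is the edge from A to rA(A).
data Kind : Set where
  T P : Kind

-- Flag (g , k) stands for the flag g · F_k.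
Flag : Set
Flag = Word × Kind

data _≈⟨_⟩_ : Flag → ℕ → Flag → Set where
  mk≈ : ∀ {p u v k} → u ∼⟨ p ⟩ v → (u , k) ≈⟨ p ⟩ (v , k)

-- The flag involutions: s0 changes the vertex, s1 the edge, s2 the tile.
s0 : Flag → Flag
s0 (w , k) = (w ++ (rA ∷ []) , k)

s1 : Flag → Flag
s1 (w , T) = (w ++ (rC ∷ []) , T)
s1 (w , P) = (w ++ (rB ∷ []) , P)

s2 : Flag → Flag
s2 (w , T) = (w , P)
s2 (w , P) = (w , T)

-- Symmetries of the tiling = automorphisms of its flag system.
record Aut (p : ℕ) : Set where
  field
    to       : Flag → Flag
    from     : Flag → Flag
    to-cong  : ∀ {x y} → x ≈⟨ p ⟩ y → to x ≈⟨ p ⟩ to y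
    from-cong : ∀ {x y} → x ≈⟨ p ⟩ y → from x ≈⟨ p ⟩ from y
    to-from  : ∀ x → to (from x) ≈⟨ p ⟩ x
    from-to  : ∀ x → from (to x) ≈⟨ p ⟩ x
    comm-s0  : ∀ x → to (s0 x) ≈⟨ p ⟩ s0 (to x)
    comm-s1  : ∀ x → to (s1 x) ≈⟨ p ⟩ s1 (to x)
    comm-s2  : ∀ x → to (s2 x) ≈⟨ p ⟩ s2 (to x)
open Aut public

data VStep (p : ℕ) : Flag → Flag → Set where
  vs1 : ∀ {x y} → y ≈⟨ p ⟩ s1 x → VStep p x y
  vs2 : ∀ {x y} → y ≈⟨ p ⟩ s2 x → VStep p x y
  veq : ∀ {x y} → y ≈⟨ p ⟩ x → VStep p x y

SameVertex : ℕ → Flag → Flag → Set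
SameVertex p = Star (VStep p)

-- An n-coloring of the tiles: a surjective map from tiles to Fin n, given as a
-- map on flags that is well defined and constant on each tile (s0, s1 orbits).
IsColoring : ℕ → (n : ℕ) → (Flag → Fin n) → Set
IsColoring p n c =
  (∀ {x y} → x ≈⟨ p ⟩ y → c x ≡ c y) ×
  (∀ x → c (s0 x) ≡ c x) ×
  (∀ x → c (s1 x) ≡ c x) ×
  (∀ (i : Fin n) → ∃ λ x → c x ≡ i)

-- precise (the tiling is 6-valent): all 6 colors occur at every vertex
IsPrecise : ℕ → (Flag → Fin 6) → Set
IsPrecise p c = ∀ x (i : Fin 6) → ∃ λ y → SameVertex p x y × c y ≡ i

IsPerfect : ℕ → (n : ℕ) → (Flag → Fin n) → Set
IsPerfect p n c = ∀ (φ : Aut p) → Σ (Permutation′ n) λ σ → ∀ x → c (to φ x) ≡ σ ⟨$⟩ʳ c x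

PerfectPrecise6 : ℕ → (Flag → Fin 6) → Set
PerfectPrecise6 p c = IsColoring p 6 c × IsPrecise p c × IsPerfect p 6 c

EquivColoring : ℕ → (n : ℕ) → (Flag → Fin n) → (Flag → Fin n) → Set
EquivColoring p n c d =
  Σ (Aut p) λ φ → Σ (Permutation′ n) λ σ → ∀ x → d (to φ x) ≡ σ ⟨$⟩ʳ c x

ExactlyOnePP6 : ℕ → Set
ExactlyOnePP6 p =
  Σ (Flag → Fin 6) λ c → PerfectPrecise6 p c ×
    (∀ d → PerfectPrecise6 p d → EquivColoring p 6 c d)

{-# OPTIONS --safe #-}
module Submission where

-- The flags of (3.p.3.p.3.p) form two regular orbits of the triangle group Δ(3,3,p) = ⟨rA, rB, rC⟩.
-- If 3 ∣ p, the generators act on six colors by rA ↦ (1 2)(4 5), rB ↦ (0 1)(4 5), rC ↦ (1 2)(3 4);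
-- coloring g·F_T by g(0) and g·F_P by g(3) is precise, and it is perfect because every symmetry is
-- a left translation, possibly composed with the exchange of rB and rC, which acts on the colors as
-- (0 3)(1 4)(2 5). Conversely, for a perfect precise coloring d every left translation by a
-- generator permutes the colors; the six tiles at the base vertex carry distinct colors, and the
-- relators force these permutations to be the ones above, so d is a relabeling of that coloring.
-- Then the relator (rA rB)^p fixes color 0, while rA rB acts on it as a 3-cycle, so 3 ∣ p.

open import Defs
open import Data.Nat using (ℕ; _≤_)
open import Data.Nat.Divisibility using (_∣_)
open import Function.Bundles using (_⇔_)

open import Data.Nat using (zero; suc; _*_; _+_)
open import Data.Nat.Divisibility using (divides)
open import Data.Nat.Properties using (1+n≰n)
open import Data.Fin using (Fin; _≟_; punchOut)
open import Data.Fin.Patterns using (0F; 1F; 2F; 3F; 4F; 5F)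
open import Data.Fin.Properties using (all?; any?; injective⇒≤; punchOut-injective)
open import Data.Fin.Permutation using (Permutation′; _⟨$⟩ʳ_; permutation)
open import Data.List using ([]; _∷_; _++_; [_]; map)
open import Data.List.Properties using (++-assoc; ++-identityʳ; map-++)
open import Data.List.Relation.Unary.All as All using (All; []; _∷_; universal)
open import Data.List.Relation.Unary.All.Properties using (∷ʳ⁺)
open import Data.Product using (∃; _×_; _,_; proj₁; proj₂)
open import Function using (id; _∘_)
open import Function.Bundles using (mk⇔)
open import Function.Definitions using (Injective)
open import Relation.Binary.PropositionalEquality
  using (_≡_; refl; sym; trans; cong; subst; module ≡-Reasoning)
open import Relation.Binary.Construct.Closure.ReflexiveTransitive using (ε; _◅_)
open import Relation.Nullary using (yes; no; contradiction)
open import Relation.Nullary.Decidable using (from-yes; _→-dec_)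

ρ : Gen → Fin 6 → Fin 6
ρ rA 1F = 2F
ρ rA 2F = 1F
ρ rA 4F = 5F
ρ rA 5F = 4F
ρ rA j  = j
ρ rB 0F = 1F
ρ rB 1F = 0F
ρ rB 4F = 5F
ρ rB 5F = 4F
ρ rB j  = j
ρ rC 1F = 2F
ρ rC 2F = 1F
ρ rC 3F = 4F
ρ rC 4F = 3F
ρ rC j  = j

act : Word → Fin 6 → Fin 6
act []      = id
act (g ∷ w) = ρ g ∘ act w

act⁻¹ : Word → Fin 6 → Fin 6
act⁻¹ []      = id
act⁻¹ (g ∷ w) = act⁻¹ w ∘ ρ g

ρ-involutive : ∀ g j → ρ g (ρ g j) ≡ j
ρ-involutive rA = from-yes (all? λ j → ρ rA (ρ rA j) ≟ j)
ρ-involutive rB = from-yes (all? λ j → ρ rB (ρ rB j) ≟ j)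
ρ-involutive rC = from-yes (all? λ j → ρ rC (ρ rC j) ≟ j)

act-act⁻¹ : ∀ w j → act w (act⁻¹ w j) ≡ j
act-act⁻¹ []      j = refl
act-act⁻¹ (g ∷ w) j = trans (cong (ρ g) (act-act⁻¹ w (ρ g j))) (ρ-involutive g j)

act⁻¹-act : ∀ w j → act⁻¹ w (act w j) ≡ j
act⁻¹-act []      j = refl
act⁻¹-act (g ∷ w) j = trans (cong (act⁻¹ w) (ρ-involutive g (act w j))) (act⁻¹-act w j)

act-++ : ∀ u v j → act (u ++ v) j ≡ act u (act v j)
act-++ []      v j = refl
act-++ (g ∷ u) v j = cong (ρ g) (act-++ u v j)

act-alt-AB-3 : ∀ j → act (alt 3 rA rB) j ≡ j
act-alt-AB-3 = from-yes (all? λ j → act (alt 3 rA rB) j ≟ j)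

act-alt-AB-multiple : ∀ q j → act (alt (q * 3) rA rB) j ≡ j
act-alt-AB-multiple zero    j = refl
act-alt-AB-multiple (suc q) j =
  trans (act-alt-AB-3 (act (alt (q * 3) rA rB) j)) (act-alt-AB-multiple q j)

act-alt-AB-fixes-0⇒3∣ : ∀ n → act (alt n rA rB) 0F ≡ 0F → 3 ∣ n
act-alt-AB-fixes-0⇒3∣ zero                fixes = divides 0 refl
act-alt-AB-fixes-0⇒3∣ (suc zero)          ()
act-alt-AB-fixes-0⇒3∣ (suc (suc zero))    ()
act-alt-AB-fixes-0⇒3∣ (suc (suc (suc n))) fixes
  with divides q n≡q*3 ← act-alt-AB-fixes-0⇒3∣ n
         (trans (sym (act-alt-AB-3 (act (alt n rA rB) 0F))) fixes)
  = divides (suc q) (cong (3 +_) n≡q*3)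

act-relator : ∀ {p r} → 3 ∣ p → Relator p r → ∀ j → act r j ≡ j
act-relator _                invA = ρ-involutive rA
act-relator _                invB = ρ-involutive rB
act-relator _                invC = ρ-involutive rC
act-relator _                angA = from-yes (all? λ j → act (alt 3 rC rB) j ≟ j)
act-relator _                angB = from-yes (all? λ j → act (alt 3 rC rA) j ≟ j)
act-relator (divides q refl) angC = act-alt-AB-multiple q

act-resp-∼ : ∀ {p u v} → 3 ∣ p → u ∼⟨ p ⟩ v → ∀ j → act u j ≡ act v j
act-resp-∼ 3∣p ∼refl           j = refl
act-resp-∼ 3∣p (∼sym u∼v)      j = sym (act-resp-∼ 3∣p u∼v j)
act-resp-∼ 3∣p (∼trans u∼v v∼w) j = trans (act-resp-∼ 3∣p u∼v j) (act-resp-∼ 3∣p v∼w j)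
act-resp-∼ 3∣p (∼rel u r v rel) j = begin
  act (u ++ r ++ v) j      ≡⟨ act-++ u (r ++ v) j ⟩
  act u (act (r ++ v) j)   ≡⟨ cong (act u) (act-++ r v j) ⟩
  act u (act r (act v j))  ≡⟨ cong (act u) (act-relator 3∣p rel (act v j)) ⟩
  act u (act v j)          ≡⟨ act-++ u v j ⟨
  act (u ++ v) j           ∎
  where open ≡-Reasoning

injective⇒surjective : ∀ {n} {f : Fin n → Fin n} → Injective _≡_ _≡_ f → ∀ y → ∃ λ x → f x ≡ y
injective⇒surjective {suc n} {f} f-injective y with any? (λ x → f x ≟ y)
... | yes hit = hit
... | no  miss = contradiction (injective⇒≤ squeezed-injective) 1+n≰n
  where
  squeezed : Fin (suc n) → Fin n
  squeezed x = punchOut {i = y} {j = f x} (λ y≡fx → miss (x , sym y≡fx))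

  squeezed-injective : Injective _≡_ _≡_ squeezed
  squeezed-injective eq = f-injective (punchOut-injective {i = y} _ _ eq)

surjective⇒injective : ∀ {n} {f : Fin n → Fin n} → (∀ y → ∃ λ x → f x ≡ y) → Injective _≡_ _≡_ f
surjective⇒injective {f = f} f-surjective {x} {y} fx≡fy = begin
  x              ≡⟨ retraction x ⟨
  section (f x)  ≡⟨ cong section fx≡fy ⟩
  section (f y)  ≡⟨ retraction y ⟩
  y              ∎
  where
  open ≡-Reasoning

  section : Fin _ → Fin _
  section z = proj₁ (f-surjective z)

  cancel : ∀ z → f (section z) ≡ z
  cancel z = proj₂ (f-surjective z)

  section-injective : Injective _≡_ _≡_ section
  section-injective {z} {w} eq = trans (sym (cancel z)) (trans (cong f eq) (cancel w))

  retraction : ∀ z → section (f z) ≡ z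
  retraction z with a , section-a≡z ← injective⇒surjective section-injective z =
    trans (cong (section ∘ f) (sym section-a≡z)) (trans (cong section (cancel a)) section-a≡z)

-- Brute force over the four undetermined values f 1, f 2, f 4, f 5.
ρ-rA-unique : (f : Fin 6 → Fin 6) → f 0F ≡ 0F → f 3F ≡ 3F → (∀ j → f (f j) ≡ j) →
              (∀ j → ρ rC (f (ρ rC (f (ρ rC (f j))))) ≡ j) → ∀ j → f j ≡ ρ rA j
ρ-rA-unique f f0≡0 f3≡3 involutive cube j = begin
  f j     ≡⟨ t≗f j ⟨
  t j     ≡⟨ decided (f 1F) (f 2F) (f 4F) (f 5F) t-involutive t-cube j ⟩
  ρ rA j  ∎
  where
  open ≡-Reasoning

  table : Fin 6 → Fin 6 → Fin 6 → Fin 6 → Fin 6 → Fin 6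
  table a b c d 0F = 0F
  table a b c d 1F = a
  table a b c d 2F = b
  table a b c d 3F = 3F
  table a b c d 4F = c
  table a b c d 5F = d

  decided : ∀ a b c d → let t = table a b c d in
            (∀ j → t (t j) ≡ j) → (∀ j → ρ rC (t (ρ rC (t (ρ rC (t j))))) ≡ j) →
            ∀ j → t j ≡ ρ rA j
  decided = from-yes (all? λ a → all? λ b → all? λ c → all? λ d → let t = table a b c d in
    all? (λ j → t (t j) ≟ j) →-dec
    all? (λ j → ρ rC (t (ρ rC (t (ρ rC (t j))))) ≟ j) →-dec
    all? (λ j → t j ≟ ρ rA j))

  t : Fin 6 → Fin 6
  t = table (f 1F) (f 2F) (f 4F) (f 5F)

  t≗f : ∀ j → t j ≡ f j
  t≗f 0F = sym f0≡0
  t≗f 1F = refl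
  t≗f 2F = refl
  t≗f 3F = sym f3≡3
  t≗f 4F = refl
  t≗f 5F = refl

  twice-resp-≗ : ∀ {g h : Fin 6 → Fin 6} → (∀ j → g j ≡ h j) → ∀ j → g (g j) ≡ h (h j)
  twice-resp-≗ {h = h} g≗h j = trans (g≗h _) (cong h (g≗h j))

  thrice-resp-≗ : ∀ {g h : Fin 6 → Fin 6} → (∀ j → g j ≡ h j) → ∀ j → g (g (g j)) ≡ h (h (h j))
  thrice-resp-≗ {h = h} g≗h j = trans (g≗h _) (cong h (twice-resp-≗ g≗h j))

  t-involutive : ∀ j → t (t j) ≡ j
  t-involutive j = trans (twice-resp-≗ t≗f j) (involutive j)

  t-cube : ∀ j → ρ rC (t (ρ rC (t (ρ rC (t j))))) ≡ j
  t-cube j = trans (thrice-resp-≗ (cong (ρ rC) ∘ t≗f) j) (cube j)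

module _ {p : ℕ} where

  ≡⇒∼ : ∀ {u v} → u ≡ v → u ∼⟨ p ⟩ v
  ≡⇒∼ refl = ∼refl

  ∼-∷ : ∀ {u v} g → u ∼⟨ p ⟩ v → (g ∷ u) ∼⟨ p ⟩ (g ∷ v)
  ∼-∷ g ∼refl             = ∼refl
  ∼-∷ g (∼sym u∼v)        = ∼sym (∼-∷ g u∼v)
  ∼-∷ g (∼trans u∼v v∼w) = ∼trans (∼-∷ g u∼v) (∼-∷ g v∼w)
  ∼-∷ g (∼rel u r v rel)  = ∼rel (g ∷ u) r v rel

  ∼-++ʳ : ∀ {u v} s → u ∼⟨ p ⟩ v → (u ++ s) ∼⟨ p ⟩ (v ++ s)
  ∼-++ʳ s ∼refl             = ∼refl
  ∼-++ʳ s (∼sym u∼v)        = ∼sym (∼-++ʳ s u∼v)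
  ∼-++ʳ s (∼trans u∼v v∼w) = ∼trans (∼-++ʳ s u∼v) (∼-++ʳ s v∼w)
  ∼-++ʳ s (∼rel u r v rel)  =
    ∼trans (≡⇒∼ (trans (++-assoc u (r ++ v) s) (cong (u ++_) (++-assoc r v s))))
    (∼trans (∼rel u r (v ++ s) rel) (≡⇒∼ (sym (++-assoc u v s))))

  ∼-cancel : ∀ u g v → (u ++ g ∷ g ∷ v) ∼⟨ p ⟩ (u ++ v)
  ∼-cancel u rA v = ∼rel u _ v invA
  ∼-cancel u rB v = ∼rel u _ v invB
  ∼-cancel u rC v = ∼rel u _ v invC

  braid-BC : (rB ∷ rC ∷ rB ∷ []) ∼⟨ p ⟩ (rC ∷ rB ∷ rC ∷ [])
  braid-BC =
    ∼trans (∼sym (∼rel [] (alt 3 rC rB) (rB ∷ rC ∷ rB ∷ []) angA))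
    (∼trans (∼-cancel (rC ∷ rB ∷ rC ∷ rB ∷ rC ∷ []) rB (rC ∷ rB ∷ []))
    (∼trans (∼-cancel (rC ∷ rB ∷ rC ∷ rB ∷ []) rC (rB ∷ []))
            (∼-cancel (rC ∷ rB ∷ rC ∷ []) rB [])))

  ≈-refl : ∀ {x} → x ≈⟨ p ⟩ x
  ≈-refl = mk≈ ∼refl

  ≈-trans : ∀ {x y z} → x ≈⟨ p ⟩ y → y ≈⟨ p ⟩ z → x ≈⟨ p ⟩ z
  ≈-trans (mk≈ u∼v) (mk≈ v∼w) = mk≈ (∼trans u∼v v∼w)

  ≡⇒≈ : ∀ {x y} → x ≡ y → x ≈⟨ p ⟩ y
  ≡⇒≈ refl = ≈-refl

  s0-cong : ∀ {x y} → x ≈⟨ p ⟩ y → s0 x ≈⟨ p ⟩ s0 y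
  s0-cong (mk≈ u∼v) = mk≈ (∼-++ʳ _ u∼v)

  s1-cong : ∀ {x y} → x ≈⟨ p ⟩ y → s1 x ≈⟨ p ⟩ s1 y
  s1-cong (mk≈ {k = T} u∼v) = mk≈ (∼-++ʳ _ u∼v)
  s1-cong (mk≈ {k = P} u∼v) = mk≈ (∼-++ʳ _ u∼v)

  s2-cong : ∀ {x y} → x ≈⟨ p ⟩ y → s2 x ≈⟨ p ⟩ s2 y
  s2-cong (mk≈ {k = T} u∼v) = mk≈ u∼v
  s2-cong (mk≈ {k = P} u∼v) = mk≈ u∼v

  s1-step : ∀ {x} → VStep p x (s1 x)
  s1-step = vs1 ≈-refl

  s2-step : ∀ {x} → VStep p x (s2 x)
  s2-step = vs2 ≈-refl

_◃_ : Gen → Flag → Flag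
g ◃ (w , k) = (g ∷ w , k)

swap : Kind → Kind
swap T = P
swap P = T

_⊕_ : Kind → Kind → Kind
k ⊕ T = k
k ⊕ P = swap k

⊕-identityˡ : ∀ k → T ⊕ k ≡ k
⊕-identityˡ T = refl
⊕-identityˡ P = refl

s2≡P⊕ : ∀ w k → s2 (w , k) ≡ (w , P ⊕ k)
s2≡P⊕ w T = refl
s2≡P⊕ w P = refl

-- The automorphism of Δ(3,3,p) exchanging rB and rC, applied when a symmetry exchanges the two flag orbits.
twist : Kind → Gen → Gen
twist T g  = g
twist P rA = rA
twist P rB = rC
twist P rC = rB

data FlagOp : Set where
  op₀ op₁ op₂₁₂ : FlagOp

⟦_⟧ : FlagOp → Flag → Flag
⟦ op₀ ⟧   = s0
⟦ op₁ ⟧   = s1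
⟦ op₂₁₂ ⟧ = s2 ∘ s1 ∘ s2

-- Right multiplication by a generator, expressed through the flag involutions.
opFor : Gen → Kind → FlagOp
opFor rA _ = op₀
opFor rB T = op₂₁₂
opFor rB P = op₁
opFor rC T = op₁
opFor rC P = op₂₁₂

⟦opFor⟧ : ∀ r k k₀ u → ⟦ opFor r k ⟧ (u , k ⊕ k₀) ≡ (u ++ [ twist k₀ r ] , k ⊕ k₀)
⟦opFor⟧ rA k T u = refl
⟦opFor⟧ rA k P u = refl
⟦opFor⟧ rB T T u = refl
⟦opFor⟧ rB T P u = refl
⟦opFor⟧ rB P T u = refl
⟦opFor⟧ rB P P u = refl
⟦opFor⟧ rC T T u = refl
⟦opFor⟧ rC T P u = refl
⟦opFor⟧ rC P T u = refl
⟦opFor⟧ rC P P u = refl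

module _ {p : ℕ} where

  ⟦⟧-cong : ∀ o {x y} → x ≈⟨ p ⟩ y → ⟦ o ⟧ x ≈⟨ p ⟩ ⟦ o ⟧ y
  ⟦⟧-cong op₀   = s0-cong
  ⟦⟧-cong op₁   = s1-cong
  ⟦⟧-cong op₂₁₂ = s2-cong ∘ s1-cong ∘ s2-cong

  to-⟦⟧ : ∀ (φ : Aut p) o x → to φ (⟦ o ⟧ x) ≈⟨ p ⟩ ⟦ o ⟧ (to φ x)
  to-⟦⟧ φ op₀   x = comm-s0 φ x
  to-⟦⟧ φ op₁   x = comm-s1 φ x
  to-⟦⟧ φ op₂₁₂ x =
    ≈-trans (comm-s2 φ _) (s2-cong (≈-trans (comm-s1 φ _) (s1-cong (comm-s2 φ x))))

  left-mul : Gen → Aut p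
  left-mul g = record
    { to        = g ◃_
    ; from      = g ◃_
    ; to-cong   = λ { (mk≈ u∼v) → mk≈ (∼-∷ g u∼v) }
    ; from-cong = λ { (mk≈ u∼v) → mk≈ (∼-∷ g u∼v) }
    ; to-from   = λ x → mk≈ (∼-cancel [] g (proj₁ x))
    ; from-to   = λ x → mk≈ (∼-cancel [] g (proj₁ x))
    ; comm-s0   = λ x → ≈-refl
    ; comm-s1   = λ { (w , T) → ≈-refl ; (w , P) → ≈-refl }
    ; comm-s2   = λ { (w , T) → ≈-refl ; (w , P) → ≈-refl }
    }

  idAut : Aut p
  idAut = record
    { to = id ; from = id ; to-cong = id ; from-cong = id
    ; to-from = λ _ → ≈-refl ; from-to = λ _ → ≈-refl
    ; comm-s0 = λ _ → ≈-refl ; comm-s1 = λ _ → ≈-refl ; comm-s2 = λ _ → ≈-refl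
    }

  module NormalForm (φ : Aut p) where

    g₀ : Word
    g₀ = proj₁ (to φ ([] , T))

    k₀ : Kind
    k₀ = proj₂ (to φ ([] , T))

    NormalAt : Word → Set
    NormalAt u = ∀ k → to φ (u , k) ≈⟨ p ⟩ (g₀ ++ map (twist k₀) u , k ⊕ k₀)

    normal-[] : NormalAt []
    normal-[] k = ≈-trans (to-[] k) (≡⇒≈ (cong (_, k ⊕ k₀) (sym (++-identityʳ g₀))))
      where
      to-[] : ∀ k → to φ ([] , k) ≈⟨ p ⟩ (g₀ , k ⊕ k₀)
      to-[] T = ≡⇒≈ (cong (g₀ ,_) (sym (⊕-identityˡ k₀)))
      to-[] P = ≈-trans (comm-s2 φ ([] , T)) (≡⇒≈ (s2≡P⊕ g₀ k₀))

    normal-∷ʳ : ∀ u r → NormalAt u → NormalAt (u ++ [ r ])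
    normal-∷ʳ u r normal k =
      ≈-trans (≡⇒≈ (cong (to φ) (sym (⟦opFor⟧ r k T u))))
      (≈-trans (to-⟦⟧ φ op (u , k))
      (≈-trans (⟦⟧-cong op (normal k))
               (≡⇒≈ (trans (⟦opFor⟧ r k k₀ _) (cong (_, k ⊕ k₀) reassociate)))))
      where
      op : FlagOp
      op = opFor r k

      reassociate : (g₀ ++ map (twist k₀) u) ++ [ twist k₀ r ] ≡ g₀ ++ map (twist k₀) (u ++ [ r ])
      reassociate = trans (++-assoc g₀ (map (twist k₀) u) _)
                          (cong (g₀ ++_) (sym (map-++ (twist k₀) u [ r ])))

    normal-++ : ∀ w u → NormalAt u → NormalAt (u ++ w)
    normal-++ []      u normal = subst NormalAt (sym (++-identityʳ u)) normal
    normal-++ (r ∷ w) u normal =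
      subst NormalAt (++-assoc u [ r ] w) (normal-++ w (u ++ [ r ]) (normal-∷ʳ u r normal))

    to-normalForm : ∀ w → NormalAt w
    to-normalForm w = normal-++ w [] normal-[]

base : Kind → Fin 6
base T = 0F
base P = 3F

col : Flag → Fin 6
col (w , k) = act w (base k)

-- One flag in each of the six tiles around the base vertex.
vertexFlag : Fin 6 → Flag
vertexFlag 0F = [] , T
vertexFlag 1F = rB ∷ [] , T
vertexFlag 2F = rC ∷ rB ∷ [] , T
vertexFlag 3F = [] , P
vertexFlag 4F = rC ∷ [] , P
vertexFlag 5F = rB ∷ rC ∷ [] , P

col-vertexFlag : ∀ j → col (vertexFlag j) ≡ j
col-vertexFlag = from-yes (all? λ j → col (vertexFlag j) ≟ j)

relabel : Kind → Fin 6 → Fin 6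
relabel T j  = j
relabel P 0F = 3F
relabel P 1F = 4F
relabel P 2F = 5F
relabel P 3F = 0F
relabel P 4F = 1F
relabel P 5F = 2F

relabel-involutive : ∀ k j → relabel k (relabel k j) ≡ j
relabel-involutive T j = refl
relabel-involutive P   = from-yes (all? λ j → relabel P (relabel P j) ≟ j)

ρ-twist : ∀ k g j → ρ (twist k g) (relabel k j) ≡ relabel k (ρ g j)
ρ-twist T g  j = refl
ρ-twist P rA   = from-yes (all? λ j → ρ rA (relabel P j) ≟ relabel P (ρ rA j))
ρ-twist P rB   = from-yes (all? λ j → ρ rC (relabel P j) ≟ relabel P (ρ rB j))
ρ-twist P rC   = from-yes (all? λ j → ρ rB (relabel P j) ≟ relabel P (ρ rC j))

act-twist : ∀ k w j → act (map (twist k) w) (relabel k j) ≡ relabel k (act w j)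
act-twist k []      j = refl
act-twist k (g ∷ w) j = trans (cong (ρ (twist k g)) (act-twist k w j)) (ρ-twist k g (act w j))

base-⊕ : ∀ k k₀ → base (k ⊕ k₀) ≡ relabel k₀ (base k)
base-⊕ k T = refl
base-⊕ T P = refl
base-⊕ P P = refl

module _ {p : ℕ} (3∣p : 3 ∣ p) where

  col-resp : ∀ {x y} → x ≈⟨ p ⟩ y → col x ≡ col y
  col-resp (mk≈ {k = k} u∼v) = act-resp-∼ 3∣p u∼v (base k)

  col-s0 : ∀ x → col (s0 x) ≡ col x
  col-s0 (w , T) = act-++ w _ 0F
  col-s0 (w , P) = act-++ w _ 3F

  col-s1 : ∀ x → col (s1 x) ≡ col x
  col-s1 (w , T) = act-++ w _ 0F
  col-s1 (w , P) = act-++ w _ 3F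

  col-isColoring : IsColoring p 6 col
  col-isColoring = col-resp , col-s0 , col-s1 , λ j → vertexFlag j , col-vertexFlag j

  col-vertexStar : ∀ w j → ∃ λ y → SameVertex p (w , T) y × col y ≡ act w j
  col-vertexStar w 0F = (w , T) , ε , refl
  col-vertexStar w 1F = (w ++ [ rB ] , T) , s2-step ◅ s1-step ◅ s2-step ◅ ε , act-++ w _ 0F
  col-vertexStar w 2F = ((w ++ [ rC ]) ++ [ rB ] , T) , s1-step ◅ s2-step ◅ s1-step ◅ s2-step ◅ ε ,
    trans (act-++ (w ++ [ rC ]) _ 0F) (act-++ w _ _)
  col-vertexStar w 3F = (w , P) , s2-step ◅ ε , refl
  col-vertexStar w 4F = (w ++ [ rC ] , P) , s1-step ◅ s2-step ◅ ε , act-++ w _ 3F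
  col-vertexStar w 5F = ((w ++ [ rB ]) ++ [ rC ] , P) , s2-step ◅ s1-step ◅ s2-step ◅ s1-step ◅ s2-step ◅ ε ,
    trans (act-++ (w ++ [ rB ]) _ 3F) (act-++ w _ _)

  col-isPrecise : IsPrecise p col
  col-isPrecise (w , k) i with y , star , col-y ← col-vertexStar w (act⁻¹ w i) =
    y , from-T k star , trans col-y (act-act⁻¹ w i)
    where
    from-T : ∀ k → SameVertex p (w , T) y → SameVertex p (w , k) y
    from-T T star = star
    from-T P star = s2-step ◅ star

  col-isPerfect : IsPerfect p 6 col
  col-isPerfect φ = colorPerm , col-to
    where
    open NormalForm φ

    colorPerm : Permutation′ 6
    colorPerm = permutation (act g₀ ∘ relabel k₀) (relabel k₀ ∘ act⁻¹ g₀)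
      (λ j → trans (cong (act g₀) (relabel-involutive k₀ _)) (act-act⁻¹ g₀ j))
      (λ j → trans (cong (relabel k₀) (act⁻¹-act g₀ _)) (relabel-involutive k₀ j))

    col-to : ∀ x → col (to φ x) ≡ colorPerm ⟨$⟩ʳ col x
    col-to (w , k) = begin
      col (to φ (w , k))                                     ≡⟨ col-resp (to-normalForm w k) ⟩
      act (g₀ ++ map (twist k₀) w) (base (k ⊕ k₀))           ≡⟨ act-++ g₀ _ _ ⟩
      act g₀ (act (map (twist k₀) w) (base (k ⊕ k₀)))        ≡⟨ cong (act g₀ ∘ act (map (twist k₀) w)) (base-⊕ k k₀) ⟩
      act g₀ (act (map (twist k₀) w) (relabel k₀ (base k)))  ≡⟨ cong (act g₀) (act-twist k₀ w (base k)) ⟩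
      act g₀ (relabel k₀ (act w (base k)))                   ∎
      where open ≡-Reasoning

  col-perfectPrecise : PerfectPrecise6 p col
  col-perfectPrecise = col-isColoring , col-isPrecise , col-isPerfect

data VertexGen : Gen → Set where
  isB : VertexGen rB
  isC : VertexGen rC

module Rigidity {p : ℕ} (d : Flag → Fin 6) (pp : PerfectPrecise6 p d) where

  d-resp : ∀ {x y} → x ≈⟨ p ⟩ y → d x ≡ d y
  d-resp = proj₁ (proj₁ pp)

  d-s0 : ∀ x → d (s0 x) ≡ d x
  d-s0 = proj₁ (proj₂ (proj₁ pp))

  d-s1 : ∀ x → d (s1 x) ≡ d x
  d-s1 = proj₁ (proj₂ (proj₂ (proj₁ pp)))

  d-surjective : ∀ c → ∃ λ x → d x ≡ c
  d-surjective = proj₂ (proj₂ (proj₂ (proj₁ pp)))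

  d-isPrecise : IsPrecise p d
  d-isPrecise = proj₁ (proj₂ pp)

  d-∼ : ∀ {u v k} → u ∼⟨ p ⟩ v → d (u , k) ≡ d (v , k)
  d-∼ u∼v = d-resp (mk≈ u∼v)

  σ : Gen → Fin 6 → Fin 6
  σ g c = proj₁ (proj₂ (proj₂ pp) (left-mul g)) ⟨$⟩ʳ c

  d-left-mul : ∀ g w k → d (g ∷ w , k) ≡ σ g (d (w , k))
  d-left-mul g w k = proj₂ (proj₂ (proj₂ pp) (left-mul g)) (w , k)

  σʷ : Word → Fin 6 → Fin 6
  σʷ []      = id
  σʷ (g ∷ w) = σ g ∘ σʷ w

  d-++ : ∀ u w k → d (u ++ w , k) ≡ σʷ u (d (w , k))
  d-++ []      w k = refl
  d-++ (g ∷ u) w k = trans (d-left-mul g (u ++ w) k) (cong (σ g) (d-++ u w k))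

  σʷ-relator : ∀ {r} → Relator p r → ∀ c → σʷ r c ≡ c
  σʷ-relator {r} rel c with (w , k) , refl ← d-surjective c = begin
    σʷ r (d (w , k))  ≡⟨ d-++ r w k ⟨
    d (r ++ w , k)    ≡⟨ d-∼ (∼rel [] r w rel) ⟩
    d (w , k)         ∎
    where open ≡-Reasoning

  σ-involutive : ∀ g c → σ g (σ g c) ≡ c
  σ-involutive rA = σʷ-relator invA
  σ-involutive rB = σʷ-relator invB
  σ-involutive rC = σʷ-relator invC

  vertexColor : Fin 6 → Fin 6
  vertexColor j = d (vertexFlag j)

  Intertwines : Gen → Set
  Intertwines g = ∀ j → σ g (vertexColor j) ≡ vertexColor (ρ g j)

  d≡vertexColor∘col-on : ∀ {w} → All Intertwines w → ∀ k → d (w , k) ≡ vertexColor (col (w , k))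
  d≡vertexColor∘col-on []                         T = refl
  d≡vertexColor∘col-on []                         P = refl
  d≡vertexColor∘col-on {g ∷ w} (g-intertwines ∷ gs) k = begin
    d (g ∷ w , k)                         ≡⟨ d-left-mul g w k ⟩
    σ g (d (w , k))                       ≡⟨ cong (σ g) (d≡vertexColor∘col-on gs k) ⟩
    σ g (vertexColor (act w (base k)))    ≡⟨ g-intertwines (act w (base k)) ⟩
    vertexColor (ρ g (act w (base k)))    ∎
    where open ≡-Reasoning

  intertwines-B : Intertwines rB
  intertwines-B 0F = sym (d-left-mul rB [] T)
  intertwines-B 1F = trans (sym (d-left-mul rB _ T)) (d-∼ (∼-cancel [] rB []))
  intertwines-B 2F = trans (sym (d-left-mul rB _ T)) (trans (d-∼ braid-BC) (d-s1 (rC ∷ rB ∷ [] , T)))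
  intertwines-B 3F = trans (sym (d-left-mul rB [] P)) (d-s1 ([] , P))
  intertwines-B 4F = sym (d-left-mul rB _ P)
  intertwines-B 5F = trans (sym (d-left-mul rB _ P)) (d-∼ (∼-cancel [] rB (rC ∷ [])))

  intertwines-C : Intertwines rC
  intertwines-C 0F = trans (sym (d-left-mul rC [] T)) (d-s1 ([] , T))
  intertwines-C 1F = sym (d-left-mul rC _ T)
  intertwines-C 2F = trans (sym (d-left-mul rC _ T)) (d-∼ (∼-cancel [] rC (rB ∷ [])))
  intertwines-C 3F = sym (d-left-mul rC [] P)
  intertwines-C 4F = trans (sym (d-left-mul rC _ P)) (d-∼ (∼-cancel [] rC []))
  intertwines-C 5F = trans (sym (d-left-mul rC _ P)) (trans (d-∼ (∼sym braid-BC)) (d-s1 (rB ∷ rC ∷ [] , P)))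

  vertexGen-intertwines : ∀ {g} → VertexGen g → Intertwines g
  vertexGen-intertwines isB = intertwines-B
  vertexGen-intertwines isC = intertwines-C

  AtBaseVertex : Flag → Set
  AtBaseVertex y = ∃ λ x → All VertexGen (proj₁ x) × y ≈⟨ p ⟩ x

  atBaseVertex-step : ∀ {x y} → AtBaseVertex x → VStep p x y → AtBaseVertex y
  atBaseVertex-step ((w , T) , gs , x≈) (vs1 y≈) = (w ++ [ rC ] , T) , ∷ʳ⁺ gs isC , ≈-trans y≈ (s1-cong x≈)
  atBaseVertex-step ((w , P) , gs , x≈) (vs1 y≈) = (w ++ [ rB ] , P) , ∷ʳ⁺ gs isB , ≈-trans y≈ (s1-cong x≈)
  atBaseVertex-step ((w , T) , gs , x≈) (vs2 y≈) = (w , P) , gs , ≈-trans y≈ (s2-cong x≈)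
  atBaseVertex-step ((w , P) , gs , x≈) (vs2 y≈) = (w , T) , gs , ≈-trans y≈ (s2-cong x≈)
  atBaseVertex-step (x′ , gs , x≈) (veq y≈) = x′ , gs , ≈-trans y≈ x≈

  atBaseVertex-star : ∀ {x y} → AtBaseVertex x → SameVertex p x y → AtBaseVertex y
  atBaseVertex-star at ε            = at
  atBaseVertex-star at (step ◅ star) = atBaseVertex-star (atBaseVertex-step at step) star

  vertexColor-surjective : ∀ c → ∃ λ j → vertexColor j ≡ c
  vertexColor-surjective c
    with y , star , dy≡c ← d-isPrecise ([] , T) c
    with (w , k) , gs , y≈ ← atBaseVertex-star (([] , T) , [] , ≈-refl) star
    = col (w , k) , (begin
      vertexColor (col (w , k))  ≡⟨ d≡vertexColor∘col-on (All.map vertexGen-intertwines gs) k ⟨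
      d (w , k)                  ≡⟨ d-resp y≈ ⟨
      d y                        ≡⟨ dy≡c ⟩
      c                          ∎)
    where open ≡-Reasoning

  vertexColor-injective : Injective _≡_ _≡_ vertexColor
  vertexColor-injective = surjective⇒injective vertexColor-surjective

  vertexColor⁻¹ : Fin 6 → Fin 6
  vertexColor⁻¹ c = proj₁ (vertexColor-surjective c)

  vertexColor-vertexColor⁻¹ : ∀ c → vertexColor (vertexColor⁻¹ c) ≡ c
  vertexColor-vertexColor⁻¹ c = proj₂ (vertexColor-surjective c)

  -- rB and rC fix the base vertex, so the relators determine their action on vertex colors;
  -- rA moves it, and its action is pinned down only through ρ-rA-unique.
  ρA′ : Fin 6 → Fin 6
  ρA′ j = vertexColor⁻¹ (σ rA (vertexColor j))

  vertexColor-ρA′ : ∀ j → vertexColor (ρA′ j) ≡ σ rA (vertexColor j)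
  vertexColor-ρA′ j = vertexColor-vertexColor⁻¹ _

  ρA′-fixes-base : ∀ k → ρA′ (base k) ≡ base k
  ρA′-fixes-base k = vertexColor-injective (begin
    vertexColor (ρA′ (base k))   ≡⟨ vertexColor-ρA′ (base k) ⟩
    σ rA (vertexColor (base k))  ≡⟨ cong (σ rA ∘ d) (vertexFlag-base k) ⟩
    σ rA (d ([] , k))            ≡⟨ d-left-mul rA [] k ⟨
    d (s0 ([] , k))              ≡⟨ d-s0 ([] , k) ⟩
    d ([] , k)                   ≡⟨ cong d (vertexFlag-base k) ⟨
    vertexColor (base k)         ∎)
    where
    open ≡-Reasoning
    vertexFlag-base : ∀ k → vertexFlag (base k) ≡ ([] , k)
    vertexFlag-base T = refl
    vertexFlag-base P = refl

  ρA′-involutive : ∀ j → ρA′ (ρA′ j) ≡ j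
  ρA′-involutive j = vertexColor-injective (begin
    vertexColor (ρA′ (ρA′ j))   ≡⟨ vertexColor-ρA′ (ρA′ j) ⟩
    σ rA (vertexColor (ρA′ j))  ≡⟨ cong (σ rA) (vertexColor-ρA′ j) ⟩
    σ rA (σ rA (vertexColor j)) ≡⟨ σ-involutive rA (vertexColor j) ⟩
    vertexColor j               ∎)
    where open ≡-Reasoning

  ρA′-cube : ∀ j → ρ rC (ρA′ (ρ rC (ρA′ (ρ rC (ρA′ j))))) ≡ j
  ρA′-cube j = vertexColor-injective (begin
    vertexColor (ρ rC (ρA′ (ρ rC (ρA′ (ρ rC (ρA′ j))))))  ≡⟨ vertexColor-ρCρA′ _ ⟩
    σ rC (σ rA (vertexColor (ρ rC (ρA′ (ρ rC (ρA′ j))))))  ≡⟨ cong (σ rC ∘ σ rA) (vertexColor-ρCρA′ _) ⟩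
    σ rC (σ rA (σ rC (σ rA (vertexColor (ρ rC (ρA′ j))))))
      ≡⟨ cong (σ rC ∘ σ rA ∘ σ rC ∘ σ rA) (vertexColor-ρCρA′ j) ⟩
    σʷ (alt 3 rC rA) (vertexColor j)                         ≡⟨ σʷ-relator angB _ ⟩
    vertexColor j                                            ∎)
    where
    open ≡-Reasoning
    vertexColor-ρCρA′ : ∀ j → vertexColor (ρ rC (ρA′ j)) ≡ σ rC (σ rA (vertexColor j))
    vertexColor-ρCρA′ j = trans (sym (intertwines-C (ρA′ j))) (cong (σ rC) (vertexColor-ρA′ j))

  intertwines-A : Intertwines rA
  intertwines-A j = begin
    σ rA (vertexColor j)   ≡⟨ vertexColor-ρA′ j ⟨
    vertexColor (ρA′ j)    ≡⟨ cong vertexColor ρA′≡ρA ⟩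
    vertexColor (ρ rA j)   ∎
    where
    open ≡-Reasoning
    ρA′≡ρA : ρA′ j ≡ ρ rA j
    ρA′≡ρA = ρ-rA-unique ρA′ (ρA′-fixes-base T) (ρA′-fixes-base P) ρA′-involutive ρA′-cube j

  intertwines : ∀ g → Intertwines g
  intertwines rA = intertwines-A
  intertwines rB = intertwines-B
  intertwines rC = intertwines-C

  d≡vertexColor∘col : ∀ x → d x ≡ vertexColor (col x)
  d≡vertexColor∘col (w , k) = d≡vertexColor∘col-on (universal intertwines w) k

  vertexColorPerm : Permutation′ 6
  vertexColorPerm = permutation vertexColor vertexColor⁻¹ vertexColor-vertexColor⁻¹
    (λ j → vertexColor-injective (vertexColor-vertexColor⁻¹ (vertexColor j)))

  col-equivalent : EquivColoring p 6 col d
  col-equivalent = idAut , vertexColorPerm , d≡vertexColor∘col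

  3∣p : 3 ∣ p
  3∣p = act-alt-AB-fixes-0⇒3∣ p (vertexColor-injective (begin
    vertexColor (col (r , T))   ≡⟨ d≡vertexColor∘col (r , T) ⟨
    d (r , T)                   ≡⟨ cong (λ w → d (w , T)) (++-identityʳ r) ⟨
    d (r ++ [] , T)             ≡⟨ d-++ r [] T ⟩
    σʷ r (d ([] , T))           ≡⟨ σʷ-relator angC _ ⟩
    d ([] , T)                  ∎))
    where
    open ≡-Reasoning
    r : Word
    r = alt p rA rB

-- The hypothesis 3 ≤ p only ensures that the tiling exists; the combinatorial argument works for every p.
proposition2p5 : (p : ℕ) → 3 ≤ p → (ExactlyOnePP6 p ⇔ 3 ∣ p)
proposition2p5 p _ = mk⇔
  (λ { (c , pp , _) → Rigidity.3∣p c pp })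
  (λ 3∣p → col , col-perfectPrecise 3∣p , Rigidity.col-equivalent)
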